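{- Let $t\geq 3$, $k\geq 3$, $1\leq n_1\leq n_2\leq\dots\leq n_t$ and $1\leq m_1\leq m_2\leq\dots\leq m_k$ be integers. Then $$\gamma_{P,c}(K_{n_1,n_2,\dots,n_t}\times K_{m_1,m_2,\dots,m_k})=\begin{cases}2, & \text{if } n_1=n_2=1 \text{ and } m_1=m_2=1,\\ 3, & \text{otherwise.}\end{cases}$$
   Context: Power domination: for $S\subseteq V(X)$, start with $M(S)=N[S]$ and repeatedly add a vertex $w$ whenever some $v\in M(S)$ has $w$ as its unique neighbour outside $M(S)$; $S$ is a connected power dominating set if the final $M(S)$ is $V(X)$ and $\langle S\rangle$ is connected; $\gamma_{P,c}(X)$ is the minimum size of such a set. The tensor product $G\times H$ has vertex set $V(G)\times V(H)$, with $(a,b)\sim(x,y)$ iff $ax\in E(G)$ and $by\in E(H)$. $K_{p_1,\dots,p_r}$ is the complete multipartite graph with partite sets of sizes $p_1,\dots,p_r$. -}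

module Defs where

open import Data.Nat using (ℕ; _≤_)
open import Data.Fin using (Fin)
open import Data.List using (List; length; lookup)
open import Data.List.Membership.Propositional using (_∈_)
open import Data.List.Relation.Unary.Unique.Propositional using (Unique)
open import Data.Product using (Σ; _×_; ∃; proj₁)
open import Relation.Binary.PropositionalEquality using (_≡_; _≢_)

record Graph : Set₁ where
  field
    V   : Set
    Adj : V → V → Set
open Graph public

-- Complete multipartite graph K_{p_1,...,p_r}: the list ps = [p_1,...,p_r];
-- vertex (i , j) is the j-th vertex of the i-th partite set; two vertices are
-- adjacent iff they lie in different partite sets.
CompleteMultipartite : List ℕ → Graph
CompleteMultipartite ps = record
  { V   = Σ (Fin (length ps)) (λ i → Fin (lookup ps i))
  ; Adj = λ x y → proj₁ x ≢ proj₁ y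
  }

_⊗_ : Graph → Graph → Graph
G ⊗ H = record
  { V   = V G × V H
  ; Adj = λ x y → Adj G (proj₁ x) (proj₁ y) × Adj H (Data.Product.proj₂ x) (Data.Product.proj₂ y)
  }

module _ (X : Graph) where
  private
    W = V X
    _~_ = Adj X

  -- M(S): the final set of observed vertices of the power domination process,
  -- i.e. the least set containing N[S] and closed under the propagation rule
  -- "if v ∈ M and w is the unique neighbour of v outside M, add w".
  data Observed (S : List W) : W → Set where
    inS  : ∀ {v} → v ∈ S → Observed S v
    nbr  : ∀ {v w} → v ∈ S → v ~ w → Observed S w
    prop : ∀ {v w} → Observed S v → v ~ w →
           (∀ u → v ~ u → u ≢ w → Observed S u) → Observed S w

  PowerDominating : List W → Set
  PowerDominating S = ∀ v → Observed S v

  data WalkIn (S : List W) : W → W → Set where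
    stop : ∀ {x} → x ∈ S → WalkIn S x x
    step : ∀ {x y z} → x ∈ S → x ~ y → WalkIn S y z → WalkIn S x z

  InducedConnected : List W → Set
  InducedConnected S = ∀ x y → x ∈ S → y ∈ S → WalkIn S x y

  IsCPDS : List W → Set
  IsCPDS S = Unique S × InducedConnected S × PowerDominating S

  γPc≡ : ℕ → Set
  γPc≡ k = (∃ λ S → IsCPDS S × length S ≡ k) × (∀ S → IsCPDS S → k ≤ length S)

{-# OPTIONS --safe #-}
-- Lower bounds come from forts: a set F such that no vertex outside F has
-- exactly one neighbour in F is never entered by propagation if it avoids N[S].
-- Group the vertices of the product into cells, indexed by a row (a part of the
-- first factor) and a column (a part of the second); adjacency only depends on
-- the cells.  The cross of a cell
-- (the rest of its row and column) is a fort avoiding N[s] for s in the cell,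
-- so one vertex never suffices.  The ends of an edge lie on the crosses of two
-- cells, and each of these cells is a fort avoiding N[S] unless it is a single
-- vertex, which forces n₁ = n₂ = m₁ = m₂ = 1.  Conversely three vertices in
-- distinct rows and columns dominate everything, and when n₁ = n₂ = m₁ = m₂ = 1
-- the edge (0,0)(1,1) dominates all but (0,1) and (1,0), each of which is then
-- forced by a vertex in a third column or row.
module Submission where

open import Defs
open import Data.Nat using (ℕ; _≤_; _≤?_; z≤n; s≤s; s≤s⁻¹)
open import Data.Nat.Properties using (≤-refl; ≤-trans; ≤-antisym; ≰⇒>)
open import Data.List using (List; []; _∷_; length; lookup)
import Data.List.Relation.Unary.All as All
open import Data.List.Relation.Unary.All using (All; []; _∷_)
import Data.List.Relation.Unary.AllPairs as AllPairs
open import Data.List.Relation.Unary.AllPairs using (AllPairs; []; _∷_)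
open import Data.List.Relation.Unary.Linked using (Linked; _∷_)
open import Data.List.Relation.Unary.Any using (here; there)
open import Data.List.Membership.Propositional using (_∈_)
open import Data.List.Membership.Propositional.Properties using (∈-lookup)
open import Data.Fin using (Fin; zero; suc; _≟_; fromℕ<)
open import Data.Product using (Σ-syntax; ∃; _×_; _,_; proj₁; proj₂)
open import Data.Product.Properties using (≡-dec)
open import Data.Sum using (_⊎_; inj₁; inj₂)
open import Data.Empty using (⊥-elim)
open import Relation.Nullary using (¬_; yes; no)
open import Relation.Binary.Definitions using (DecidableEquality)
open import Relation.Binary.PropositionalEquality using (_≡_; _≢_; refl; sym; ≢-sym; cong)

module _ (X : Graph) where

  IsFort : (V X → Set) → Set
  IsFort F = ∀ {v w} → ¬ F v → Adj X v w → F w →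
             ∃ λ u → Adj X v u × u ≢ w × F u

  observed-outside-fort : ∀ {F S} → IsFort F →
    (∀ {s} → s ∈ S → ¬ F s) → (∀ {s w} → s ∈ S → Adj X s w → ¬ F w) →
    ∀ {w} → Observed X S w → ¬ F w
  observed-outside-fort fort S∉F _ (inS s∈S) = S∉F s∈S
  observed-outside-fort fort _ NS∉F (nbr s∈S s~w) = NS∉F s∈S s~w
  observed-outside-fort fort S∉F NS∉F (prop v-obs v~w others) Fw
    with fort (observed-outside-fort fort S∉F NS∉F v-obs) v~w Fw
  ... | u , v~u , u≢w , Fu = observed-outside-fort fort S∉F NS∉F (others _ v~u u≢w) Fu

  fort-¬powerDominating : ∀ {F S} → IsFort F →
    (∀ {s} → s ∈ S → ¬ F s) → (∀ {s w} → s ∈ S → Adj X s w → ¬ F w) →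
    ∀ {w} → F w → ¬ PowerDominating X S
  fort-¬powerDominating fort S∉F NS∉F Fw pd =
    observed-outside-fort fort S∉F NS∉F (pd _) Fw

  ¬observed[] : ∀ {w} → ¬ Observed X [] w
  ¬observed[] (prop v-obs _ _) = ¬observed[] v-obs

  walk-weaken : ∀ {s S x y} → WalkIn X S x y → WalkIn X (s ∷ S) x y
  walk-weaken (stop x∈S) = stop (there x∈S)
  walk-weaken (step x∈S x~y walk) = step (there x∈S) x~y (walk-weaken walk)

  walk-start : ∀ {S x y} → WalkIn X S x y → x ∈ S
  walk-start (stop x∈S) = x∈S
  walk-start (step x∈S _ _) = x∈S

  clique-connected : (∀ {x y} → Adj X x y → Adj X y x) →
    ∀ {S} → AllPairs (Adj X) S → InducedConnected X S
  clique-connected sym~ (s~S ∷ _) _ _ (here refl) (here refl) = stop (here refl)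
  clique-connected sym~ (s~S ∷ _) _ _ (here refl) (there y∈S) =
    step (here refl) (All.lookup s~S y∈S) (stop (there y∈S))
  clique-connected sym~ (s~S ∷ _) _ _ (there x∈S) (here refl) =
    step (there x∈S) (sym~ (All.lookup s~S x∈S)) (stop (here refl))
  clique-connected sym~ (_ ∷ clique) _ _ (there x∈S) (there y∈S) =
    walk-weaken (clique-connected sym~ clique _ _ x∈S y∈S)

  connected-pair-adjacent : (∀ {x} → ¬ Adj X x x) → ∀ {x y} → x ≢ y →
    InducedConnected X (x ∷ y ∷ []) → Adj X x y
  connected-pair-adjacent irrefl x≢y connected
    with connected _ _ (here refl) (there (here refl))
  ... | stop _ = ⊥-elim (x≢y refl)
  ... | step _ x~z walk with walk-start walk
  ...   | here refl = ⊥-elim (irrefl x~z)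
  ...   | there (here refl) = x~z

fresh : ∀ {n} → 3 ≤ n → (i j : Fin n) → ∃ λ k → k ≢ i × k ≢ j
fresh (s≤s (s≤s (s≤s _))) zero zero = suc zero , (λ ()) , (λ ())
fresh (s≤s (s≤s (s≤s _))) zero (suc zero) = suc (suc zero) , (λ ()) , (λ ())
fresh (s≤s (s≤s (s≤s _))) zero (suc (suc _)) = suc zero , (λ ()) , (λ ())
fresh (s≤s (s≤s (s≤s _))) (suc zero) zero = suc (suc zero) , (λ ()) , (λ ())
fresh (s≤s (s≤s (s≤s _))) (suc zero) (suc _) = zero , (λ ()) , (λ ())
fresh (s≤s (s≤s (s≤s _))) (suc (suc _)) zero = suc zero , (λ ()) , (λ ())
fresh (s≤s (s≤s (s≤s _))) (suc (suc _)) (suc _) = zero , (λ ()) , (λ ())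

another : ∀ {n} → 2 ≤ n → (j : Fin n) → ∃ λ k → k ≢ j
another (s≤s (s≤s _)) zero = suc zero , λ ()
another (s≤s (s≤s _)) (suc _) = zero , λ ()

distinct₃ : ∀ {n} → 3 ≤ n →
  Σ[ a ∈ Fin n ] Σ[ b ∈ Fin n ] Σ[ c ∈ Fin n ] a ≢ b × a ≢ c × b ≢ c
distinct₃ (s≤s (s≤s (s≤s _))) =
  zero , suc zero , suc (suc zero) , (λ ()) , (λ ()) , (λ ())

-- Among three cells on distinct rows and distinct columns, at most one shares
-- a row with (p , q) and at most one shares a column.
avoid-one-of-three : ∀ {n m} {a₀ a₁ a₂ : Fin n} {b₀ b₁ b₂ : Fin m} →
  a₀ ≢ a₁ → a₀ ≢ a₂ → a₁ ≢ a₂ → b₀ ≢ b₁ → b₀ ≢ b₂ → b₁ ≢ b₂ →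
  ∀ p q → (a₀ ≢ p × b₀ ≢ q) ⊎ (a₁ ≢ p × b₁ ≢ q) ⊎ (a₂ ≢ p × b₂ ≢ q)
avoid-one-of-three {a₀ = a₀} {a₁} {b₀ = b₀} {b₁} a₀₁ a₀₂ a₁₂ b₀₁ b₀₂ b₁₂ p q
  with p ≟ a₀ | q ≟ b₀ | p ≟ a₁ | q ≟ b₁
... | no p≢a₀ | no q≢b₀ | _ | _ = inj₁ (≢-sym p≢a₀ , ≢-sym q≢b₀)
... | no _ | yes refl | no p≢a₁ | _ = inj₂ (inj₁ (≢-sym p≢a₁ , ≢-sym b₀₁))
... | no _ | yes refl | yes refl | _ = inj₂ (inj₂ (≢-sym a₁₂ , ≢-sym b₀₂))
... | yes refl | _ | _ | no q≢b₁ = inj₂ (inj₁ (≢-sym a₀₁ , ≢-sym q≢b₁))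
... | yes refl | _ | _ | yes refl = inj₂ (inj₂ (≢-sym a₀₂ , ≢-sym b₁₂))

StartsWithOneOne : List ℕ → Set
StartsWithOneOne xs = ∃ λ xs' → xs ≡ 1 ∷ 1 ∷ xs'

¬2≤⇒≤1 : ∀ {n} → ¬ 2 ≤ n → n ≤ 1
¬2≤⇒≤1 2≰n = s≤s⁻¹ (≰⇒> 2≰n)

head≤lookup : ∀ {x xs} → Linked _≤_ (x ∷ xs) →
  (i : Fin (length (x ∷ xs))) → x ≤ lookup (x ∷ xs) i
head≤lookup _ zero = ≤-refl
head≤lookup (x≤y ∷ sorted) (suc i) = ≤-trans x≤y (head≤lookup sorted i)

leading-ones : ∀ {x y xs} → All (1 ≤_) (x ∷ y ∷ xs) → x ≤ 1 → y ≤ 1 →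
  StartsWithOneOne (x ∷ y ∷ xs)
leading-ones (1≤x ∷ 1≤y ∷ _) x≤1 y≤1
  with ≤-antisym x≤1 1≤x | ≤-antisym y≤1 1≤y
... | refl | refl = _ , refl

sorted-two-ones : ∀ {xs} → All (1 ≤_) xs → Linked _≤_ xs →
  (i j : Fin (length xs)) → i ≢ j → lookup xs i ≤ 1 → lookup xs j ≤ 1 →
  StartsWithOneOne xs
sorted-two-ones {_ ∷ _} _ _ zero zero i≢j _ _ = ⊥-elim (i≢j refl)
sorted-two-ones {_ ∷ _ ∷ _} pos (x≤y ∷ sorted) zero (suc j) _ xᵢ≤1 xⱼ≤1 =
  leading-ones pos xᵢ≤1 (≤-trans (head≤lookup sorted j) xⱼ≤1)
sorted-two-ones {_ ∷ _ ∷ _} pos (x≤y ∷ sorted) (suc i) j _ xᵢ≤1 xⱼ≤1 =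
  leading-ones pos (≤-trans (head≤lookup (x≤y ∷ sorted) j) xⱼ≤1)
                   (≤-trans (head≤lookup sorted i) xᵢ≤1)

module Tensor (ns ms : List ℕ) (pos-ns : All (1 ≤_) ns) (pos-ms : All (1 ≤_) ms)
              (3≤ns : 3 ≤ length ns) (3≤ms : 3 ≤ length ms) where

  X : Graph
  X = CompleteMultipartite ns ⊗ CompleteMultipartite ms

  Vertex : Set
  Vertex = V X

  partA : Vertex → Fin (length ns)
  partA v = proj₁ (proj₁ v)

  partB : Vertex → Fin (length ms)
  partB v = proj₁ (proj₂ v)

  vertex : Fin (length ns) → Fin (length ms) → Vertex
  vertex i j = (i , fromℕ< (All.lookup pos-ns (∈-lookup i)))
             , (j , fromℕ< (All.lookup pos-ms (∈-lookup j)))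

  _≟ᵥ_ : DecidableEquality Vertex
  _≟ᵥ_ = ≡-dec (≡-dec _≟_ _≟_) (≡-dec _≟_ _≟_)

  ~-sym : ∀ {x y} → Adj X x y → Adj X y x
  ~-sym (a , b) = ≢-sym a , ≢-sym b

  ~-irrefl : ∀ {x} → ¬ Adj X x x
  ~-irrefl (a , _) = a refl

  ~⇒≢ : ∀ {x y} → Adj X x y → x ≢ y
  ~⇒≢ {x} x~y refl = ~-irrefl {x} x~y

  clique-cpds : ∀ {S} → AllPairs (Adj X) S → PowerDominating X S → IsCPDS X S
  clique-cpds clique pd =
    AllPairs.map (λ {x} → ~⇒≢ {x}) clique ,
    clique-connected X (λ {x} {y} → ~-sym {x} {y}) clique , pd

  record Cell (i : Fin (length ns)) (j : Fin (length ms)) (v : Vertex) : Set where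
    constructor cell
    field
      row≡    : partA v ≡ i
      column≡ : partB v ≡ j

  data Cross (i : Fin (length ns)) (j : Fin (length ms)) (v : Vertex) : Set where
    same-row    : partA v ≡ i → partB v ≢ j → Cross i j v
    same-column : partA v ≢ i → partB v ≡ j → Cross i j v

  -- All vertices of a cell are twins, so a second one is always available.
  cell-fort : ∀ {i j} → 2 ≤ lookup ns i ⊎ 2 ≤ lookup ms j → IsFort X (Cell i j)
  cell-fort (inj₁ 2≤) {w = (a , x) , b} _ v~w (cell refl refl) with another 2≤ x
  ... | x' , x'≢x = ((a , x') , b) , v~w , (λ { refl → x'≢x refl }) , cell refl refl
  cell-fort (inj₂ 2≤) {w = a , (b , y)} _ v~w (cell refl refl) with another 2≤ y
  ... | y' , y'≢y = (a , (b , y')) , v~w , (λ { refl → y'≢y refl }) , cell refl refl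

  cross-fort : ∀ {i j} → IsFort X (Cross i j)
  cross-fort {i} {j} {v} v∉ (a , _) (same-row refl _) with partB v ≟ j
  ... | yes refl = ⊥-elim (v∉ (same-column a refl))
  ... | no b with fresh 3≤ns (partA v) i
  ...   | k , k≢v , k≢i =
    vertex k j , (≢-sym k≢v , b) , (λ u≡w → k≢i (cong partA u≡w)) , same-column k≢i refl
  cross-fort {i} {j} {v} v∉ (_ , b) (same-column _ refl) with partA v ≟ i
  ... | yes refl = ⊥-elim (v∉ (same-row refl b))
  ... | no a with fresh 3≤ms (partB v) j
  ...   | k , k≢v , k≢j =
    vertex i k , (a , ≢-sym k≢v) , (λ u≡w → k≢j (cong partB u≡w)) , same-row refl k≢j

  cell-∉-cross : ∀ {i j s} → Cross i j s → ¬ Cell i j s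
  cell-∉-cross (same-row _ b) (cell _ b≡) = b b≡
  cell-∉-cross (same-column a _) (cell a≡ _) = a a≡

  cell-∉-nbr-cross : ∀ {i j s w} → Cross i j s → Adj X s w → ¬ Cell i j w
  cell-∉-nbr-cross (same-row refl _) (a , _) (cell a≡ _) = a (sym a≡)
  cell-∉-nbr-cross (same-column _ refl) (_ , b) (cell _ b≡) = b (sym b≡)

  cross-∉-cell : ∀ {i j s} → Cell i j s → ¬ Cross i j s
  cross-∉-cell (cell _ b≡) (same-row _ b) = b b≡
  cross-∉-cell (cell a≡ _) (same-column a _) = a a≡

  cross-∉-nbr-cell : ∀ {i j s w} → Cell i j s → Adj X s w → ¬ Cross i j w
  cross-∉-nbr-cell (cell refl _) (a , _) (same-row a≡ _) = a (sym a≡)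
  cross-∉-nbr-cell (cell _ refl) (_ , b) (same-column _ b≡) = b (sym b≡)

  ¬powerDominating-[] : ¬ PowerDominating X []
  ¬powerDominating-[] pd = ¬observed[] X (pd (vertex i j))
    where i = proj₁ (distinct₃ 3≤ns)
          j = proj₁ (distinct₃ 3≤ms)

  ¬powerDominating-[_] : ∀ s → ¬ PowerDominating X (s ∷ [])
  ¬powerDominating-[ s ] with fresh 3≤ms (partB s) (partB s)
  ... | k , k≢ , _ = fort-¬powerDominating X cross-fort
    (λ { (here refl) → cross-∉-cell (cell refl refl) })
    (λ { {w = w} (here refl) → cross-∉-nbr-cell {s = s} {w} (cell refl refl) })
    {w = vertex (partA s) k} (same-row refl k≢)

  onCross⇒¬powerDominating : ∀ {S i j} → (∀ {s} → s ∈ S → Cross i j s) →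
    2 ≤ lookup ns i ⊎ 2 ≤ lookup ms j → ¬ PowerDominating X S
  onCross⇒¬powerDominating {i = i} {j} on-cross big =
    fort-¬powerDominating X (cell-fort big)
      (λ s∈S → cell-∉-cross (on-cross s∈S))
      (λ {w = w} s∈S → cell-∉-nbr-cross {w = w} (on-cross s∈S))
      {w = vertex i j} (cell refl refl)

  powerDominating-onCross⇒singleton-cell : ∀ {S i j} →
    (∀ {s} → s ∈ S → Cross i j s) → PowerDominating X S →
    lookup ns i ≤ 1 × lookup ms j ≤ 1
  powerDominating-onCross⇒singleton-cell {i = i} {j} on-cross pd
    with 2 ≤? lookup ns i | 2 ≤? lookup ms j
  ... | yes 2≤ | _ = ⊥-elim (onCross⇒¬powerDominating on-cross (inj₁ 2≤) pd)
  ... | _ | yes 2≤ = ⊥-elim (onCross⇒¬powerDominating on-cross (inj₂ 2≤) pd)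
  ... | no 2≰ | no 2≰' = ¬2≤⇒≤1 2≰ , ¬2≤⇒≤1 2≰'

  cpds-size≥2 : ∀ {S} → IsCPDS X S → 2 ≤ length S
  cpds-size≥2 {[]} (_ , _ , pd) = ⊥-elim (¬powerDominating-[] pd)
  cpds-size≥2 {s ∷ []} (_ , _ , pd) = ⊥-elim (¬powerDominating-[ s ] pd)
  cpds-size≥2 {_ ∷ _ ∷ _} _ = s≤s (s≤s z≤n)

  cpds-pair⇒leading-ones : Linked _≤_ ns → Linked _≤_ ms →
    ∀ {s₁ s₂} → IsCPDS X (s₁ ∷ s₂ ∷ []) → StartsWithOneOne ns × StartsWithOneOne ms
  cpds-pair⇒leading-ones sorted-ns sorted-ms {s₁} {s₂}
                         (((s₁≢s₂ ∷ []) ∷ _) , connected , pd)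
    with connected-pair-adjacent X (λ {x} → ~-irrefl {x}) s₁≢s₂ connected
  ... | a , b
    with powerDominating-onCross⇒singleton-cell {i = partA s₂} {partB s₁}
           (λ { (here refl) → same-column a refl
              ; (there (here refl)) → same-row refl (≢-sym b) }) pd
       | powerDominating-onCross⇒singleton-cell {i = partA s₁} {partB s₂}
           (λ { (here refl) → same-row refl b
              ; (there (here refl)) → same-column (≢-sym a) refl }) pd
  ... | nA₂≤1 , mB₁≤1 | nA₁≤1 , mB₂≤1 =
    sorted-two-ones pos-ns sorted-ns (partA s₁) (partA s₂) a nA₁≤1 nA₂≤1 ,
    sorted-two-ones pos-ms sorted-ms (partB s₁) (partB s₂) b mB₁≤1 mB₂≤1

  cpds-size≥3 : Linked _≤_ ns → Linked _≤_ ms →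
    ¬ (StartsWithOneOne ns × StartsWithOneOne ms) → ∀ {S} → IsCPDS X S → 3 ≤ length S
  cpds-size≥3 _ _ _ {[]} (_ , _ , pd) = ⊥-elim (¬powerDominating-[] pd)
  cpds-size≥3 _ _ _ {s ∷ []} (_ , _ , pd) = ⊥-elim (¬powerDominating-[ s ] pd)
  cpds-size≥3 sorted-ns sorted-ms ¬ones {_ ∷ _ ∷ []} cpds =
    ⊥-elim (¬ones (cpds-pair⇒leading-ones sorted-ns sorted-ms cpds))
  cpds-size≥3 _ _ _ {_ ∷ _ ∷ _ ∷ _} _ = s≤s (s≤s (s≤s z≤n))

  diagonal-cpds : ∃ λ S → IsCPDS X S × length S ≡ 3
  diagonal-cpds with distinct₃ 3≤ns | distinct₃ 3≤ms
  ... | a₀ , a₁ , a₂ , a₀₁ , a₀₂ , a₁₂ | b₀ , b₁ , b₂ , b₀₁ , b₀₂ , b₁₂ =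
    S , clique-cpds clique dominating , refl
    where
      S : List Vertex
      S = vertex a₀ b₀ ∷ vertex a₁ b₁ ∷ vertex a₂ b₂ ∷ []

      clique : AllPairs (Adj X) S
      clique = ((a₀₁ , b₀₁) ∷ (a₀₂ , b₀₂) ∷ []) ∷ ((a₁₂ , b₁₂) ∷ []) ∷ [] ∷ []

      dominating : PowerDominating X S
      dominating u with avoid-one-of-three a₀₁ a₀₂ a₁₂ b₀₁ b₀₂ b₁₂ (partA u) (partB u)
      ... | inj₁ s₀~u = nbr (here refl) s₀~u
      ... | inj₂ (inj₁ s₁~u) = nbr (there (here refl)) s₁~u
      ... | inj₂ (inj₂ s₂~u) = nbr (there (there (here refl))) s₂~u

module Corner (ns ms : List ℕ)
              (pos-ns : All (1 ≤_) (1 ∷ 1 ∷ ns)) (pos-ms : All (1 ≤_) (1 ∷ 1 ∷ ms))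
              (3≤ns : 3 ≤ length (1 ∷ 1 ∷ ns)) (3≤ms : 3 ≤ length (1 ∷ 1 ∷ ms)) where

  open Tensor (1 ∷ 1 ∷ ns) (1 ∷ 1 ∷ ms) pos-ns pos-ms 3≤ns 3≤ms

  s₁ s₂ w₀₁ w₁₀ : Vertex
  s₁ = (zero , zero) , (zero , zero)
  s₂ = (suc zero , zero) , (suc zero , zero)
  w₀₁ = (zero , zero) , (suc zero , zero)
  w₁₀ = (suc zero , zero) , (zero , zero)

  S : List Vertex
  S = s₁ ∷ s₂ ∷ []

  s₁∈S : s₁ ∈ S
  s₁∈S = here refl

  s₂∈S : s₂ ∈ S
  s₂∈S = there (here refl)

  dominated : ∀ u → u ≢ w₀₁ → u ≢ w₁₀ → Observed X S u
  dominated ((zero , zero) , (zero , zero)) _ _ = inS s₁∈S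
  dominated ((zero , zero) , (suc zero , zero)) u≢w₀₁ _ = ⊥-elim (u≢w₀₁ refl)
  dominated ((zero , _) , (suc (suc _) , _)) _ _ = nbr s₂∈S ((λ ()) , (λ ()))
  dominated ((suc zero , zero) , (zero , zero)) _ u≢w₁₀ = ⊥-elim (u≢w₁₀ refl)
  dominated ((suc zero , zero) , (suc zero , zero)) _ _ = inS s₂∈S
  dominated ((suc zero , _) , (suc (suc _) , _)) _ _ = nbr s₁∈S ((λ ()) , (λ ()))
  dominated ((suc (suc _) , _) , (zero , _)) _ _ = nbr s₂∈S ((λ ()) , (λ ()))
  dominated ((suc (suc _) , _) , (suc _ , _)) _ _ = nbr s₁∈S ((λ ()) , (λ ()))

  observed-w₀₁ : Observed X S w₀₁
  observed-w₀₁ with fresh 3≤ms zero (suc zero)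
  ... | k , k≢0 , k≢1 =
    prop {v = vertex (suc zero) k} (nbr s₁∈S ((λ ()) , ≢-sym k≢0)) ((λ ()) , k≢1)
      (λ u v~u u≢w₀₁ → dominated u u≢w₀₁ (λ { refl → proj₁ v~u refl }))

  observed-w₁₀ : Observed X S w₁₀
  observed-w₁₀ with fresh 3≤ns zero (suc zero)
  ... | k , k≢0 , k≢1 =
    prop {v = vertex k (suc zero)} (nbr s₁∈S (≢-sym k≢0 , (λ ()))) (k≢1 , (λ ()))
      (λ u v~u u≢w₁₀ → dominated u (λ { refl → proj₂ v~u refl }) u≢w₁₀)

  corner-cpds : ∃ λ S → IsCPDS X S × length S ≡ 2
  corner-cpds = S , clique-cpds ((((λ ()) , (λ ())) ∷ []) ∷ [] ∷ []) powerDominating , refl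
    where
      powerDominating : PowerDominating X S
      powerDominating u with u ≟ᵥ w₀₁ | u ≟ᵥ w₁₀
      ... | yes refl | _ = observed-w₀₁
      ... | no _ | yes refl = observed-w₁₀
      ... | no u≢w₀₁ | no u≢w₁₀ = dominated u u≢w₀₁ u≢w₁₀

theorem16 : (ns ms : List ℕ) →
    3 ≤ length ns → 3 ≤ length ms →
    All (1 ≤_) ns → All (1 ≤_) ms →
    Linked _≤_ ns → Linked _≤_ ms →
    let X = CompleteMultipartite ns ⊗ CompleteMultipartite ms
        C = (∃ λ ns' → ns ≡ 1 ∷ 1 ∷ ns') × (∃ λ ms' → ms ≡ 1 ∷ 1 ∷ ms')
    in (C → γPc≡ X 2) × (¬ C → γPc≡ X 3)
theorem16 ns ms 3≤ns 3≤ms pos-ns pos-ms sorted-ns sorted-ms = γ≡2 , γ≡3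
  where
    open Tensor ns ms pos-ns pos-ms 3≤ns 3≤ms

    γ≡2 : StartsWithOneOne ns × StartsWithOneOne ms → γPc≡ X 2
    γ≡2 ((ns' , refl) , (ms' , refl)) =
      Corner.corner-cpds ns' ms' pos-ns pos-ms 3≤ns 3≤ms , λ _ → cpds-size≥2

    γ≡3 : ¬ (StartsWithOneOne ns × StartsWithOneOne ms) → γPc≡ X 3
    γ≡3 ¬ones = diagonal-cpds , λ _ → cpds-size≥3 sorted-ns sorted-ms ¬ones
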